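{- Let $G$ be a unicyclic Cactus (UCC) graph with maximum degree $\Delta$. Then $\chi'_s(G)\leq \left\lfloor\frac{3\Delta}{2}\right\rfloor+1$.
   Context: All graphs are finite, simple and undirected. A star edge coloring of a graph $G$ is a proper edge coloring of $G$ (adjacent edges receive distinct colors) such that no path or cycle of length four (i.e. with four edges) is bi-colored. The star chromatic index $\chi'_s(G)$ is the minimum $k$ such that $G$ admits a star edge coloring with $k$ colors. A Cactus is a graph in which every edge belongs to at most one cycle. A unicyclic Cactus (UCC) is a Cactus $G=C\cup F$, where $C$ is a cycle (or a single edge) and $F$ is a forest consisting of rooted trees, each of height at most two, whose roots lie in $C$. The height of a rooted tree is the length of a longest path from the root to a leaf. -}

module Defs where

open import Data.Nat using (ℕ; zero; suc; _≤_; _⊔_)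
open import Data.Fin using (Fin; zero; suc)
open import Data.Fin.Properties using (_≟_)
open import Data.List using (List; length; filter; foldr; map; allFin)
open import Data.Product using (Σ; ∃; ∃-syntax; _×_; _,_)
open import Data.Sum using (_⊎_)
open import Data.Empty using (⊥)
open import Relation.Nullary using (¬_; Dec)
open import Relation.Binary.PropositionalEquality using (_≡_; _≢_)
open import Function using (_⇔_)

record Graph (n : ℕ) : Set₁ where
  field
    Adj   : Fin n → Fin n → Set
    adj?  : ∀ u v → Dec (Adj u v)
    sym   : ∀ {u v} → Adj u v → Adj v u
    irrefl : ∀ {v} → ¬ Adj v v
open Graph public

degree : ∀ {n} → Graph n → Fin n → ℕ
degree G v = length (filter (adj? G v) (allFin _))

maxDegree : ∀ {n} → Graph n → ℕ
maxDegree G = foldr _⊔_ 0 (map (degree G) (allFin _))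

record EdgeColoring {n} (G : Graph n) (k : ℕ) : Set where
  field
    col     : Fin n → Fin n → Fin k
    col-sym : ∀ {u v} → Adj G u v → col u v ≡ col v u
open EdgeColoring public

Proper : ∀ {n k} {G : Graph n} → EdgeColoring G k → Set
Proper {G = G} c =
  ∀ {u v w} → Adj G u v → Adj G u w → v ≢ w → col c u v ≢ col c u w

-- a path or cycle of length four: v0 v1 v2 v3 v4 with consecutive
-- vertices adjacent and all vertices pairwise distinct, except that
-- v0 = v4 is allowed (then it is a 4-cycle).
record PathOrCycle4 {n} (G : Graph n) (v0 v1 v2 v3 v4 : Fin n) : Set where
  field
    a01 : Adj G v0 v1
    a12 : Adj G v1 v2
    a23 : Adj G v2 v3
    a34 : Adj G v3 v4
    d01 : v0 ≢ v1
    d02 : v0 ≢ v2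
    d03 : v0 ≢ v3
    d12 : v1 ≢ v2
    d13 : v1 ≢ v3
    d14 : v1 ≢ v4
    d23 : v2 ≢ v3
    d24 : v2 ≢ v4
    d34 : v3 ≢ v4

BiColored : ∀ {n k} {G : Graph n} → EdgeColoring G k → (v0 v1 v2 v3 v4 : Fin n) → Set
BiColored c v0 v1 v2 v3 v4 =
  ∃[ a ] ∃[ b ]
    ((col c v0 v1 ≡ a ⊎ col c v0 v1 ≡ b) ×
     (col c v1 v2 ≡ a ⊎ col c v1 v2 ≡ b) ×
     (col c v2 v3 ≡ a ⊎ col c v2 v3 ≡ b) ×
     (col c v3 v4 ≡ a ⊎ col c v3 v4 ≡ b))

IsStarEdgeColoring : ∀ {n k} {G : Graph n} → EdgeColoring G k → Set
IsStarEdgeColoring {G = G} c =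
  Proper c ×
  (∀ v0 v1 v2 v3 v4 → PathOrCycle4 G v0 v1 v2 v3 v4 → ¬ BiColored c v0 v1 v2 v3 v4)

StarColorable : ∀ {n} → Graph n → ℕ → Set
StarColorable G k = Σ (EdgeColoring G k) IsStarEdgeColoring

-- Data: a cycle c_0 … c_{m-1} (m ≥ 2 distinct vertices;
-- m = 2 means C is a single edge) and a parent map for the vertices not on C
-- such that every vertex off C has its parent or grandparent on C (the
-- rooted trees have height ≤ 2 with roots on C).

next : ∀ {m} → Fin (suc m) → Fin (suc m)
next {zero} zero = zero
next {suc m} zero = suc zero
next {suc m} (suc i) with next {m} i
... | zero = zero
... | suc j = suc (suc j)

record UCCData (n : ℕ) : Set where
  field
    m       : ℕ
    2≤m     : 2 ≤ suc m
    cyc     : Fin (suc m) → Fin n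
    cyc-inj : ∀ {i j} → cyc i ≡ cyc j → i ≡ j
    parent  : Fin n → Fin n

  OnC : Fin n → Set
  OnC v = ∃[ i ] cyc i ≡ v

  field
    height≤2 : ∀ v → ¬ OnC v → OnC (parent v) ⊎ OnC (parent (parent v))

  CycEdge : Fin n → Fin n → Set
  CycEdge u v = ∃[ i ] ((cyc i ≡ u × cyc (next i) ≡ v) ⊎ (cyc i ≡ v × cyc (next i) ≡ u))

  TreeEdge : Fin n → Fin n → Set
  TreeEdge u v = (¬ OnC u × parent u ≡ v) ⊎ (¬ OnC v × parent v ≡ u)

  UAdj : Fin n → Fin n → Set
  UAdj u v = CycEdge u v ⊎ TreeEdge u v

IsUCC : ∀ {n} → Graph n → Set
IsUCC {n} G = Σ (UCCData n) λ D → ∀ u v → (Adj G u v ⇔ UCCData.UAdj D u v)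

-- A unicyclic cactus is the functional graph of a map up (the cycle successor on C, the parent
-- off C), so every edge is {v , up v}; it gets the colour κ v. The cycle C is star-coloured with
-- at most four colours (one if C is a single edge). The t children of a cycle vertex r get
-- distinct colours outside this palette. The children of such a child u get distinct colours
-- avoiding the cycle colours at r, the colour of {u , r}, and the colours of the ⌊t/2⌋ siblings
-- following u in a cyclic order of the children of r; since of any two siblings one lies in the
-- window of the other, no path through r is bicoloured. Degree counting shows that ⌊3Δ/2⌋ + 1
-- colours leave room for every choice.

module Submission where

open import Defs hiding (sym)
open import Data.Nat as ℕ
  using (ℕ; zero; suc; _+_; _*_; _∸_; _/_; _%_; _⊔_; _≤_; _<_; z≤n; s≤s; _≤?_; _<?_)
open import Data.Nat.Properties as ℕ
  hiding (_≟_)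
open import Data.Nat.DivMod
  using (m≡m%n+[m/n]*n; m%n<n; m<n⇒m%n≡m; [m+n]%n≡m%n; +-distrib-/; m*n%n≡0; m*n/n≡m; m/n≡1+[m∸n]/n; /-monoˡ-≤)
open import Data.Fin as Fin
  using (Fin; zero; suc; toℕ; fromℕ; fromℕ<; inject₁; inject≤; punchIn; punchOut)
open import Data.Fin.Properties
  using (punchIn-injective; punchInᵢ≢i; punchOut-punchIn; punchOut-cong; toℕ-injective;
         toℕ-inject≤; toℕ-inject₁; toℕ-inject₁-≢; toℕ-fromℕ; toℕ-fromℕ<; toℕ<n; any?)
open import Data.List as List using (List; []; _∷_; length; filter; map; upTo; foldr; allFin)
open import Data.List.Properties using (length-map; length-upTo; length-++)
open import Data.List.Membership.Propositional.Properties
  using (∈-map⁺; ∈-upTo⁺; ∈-filter⁺; ∈-allFin; ∈-++⁺ˡ; ∈-++⁺ʳ)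
open import Data.List.Membership.Propositional using (_∈_; _∉_)
open import Data.List.Relation.Unary.Any as Any using (here; there)
open import Data.List.Relation.Unary.Any.Properties using (lookup-index)
open import Data.Product using (∃-syntax; _×_; _,_; proj₁)
open import Data.Sum as Sum using (_⊎_; inj₁; inj₂)
open import Data.Empty using (⊥-elim)
open import Relation.Nullary using (¬_; Dec; yes; no; contradiction)
open import Relation.Nullary.Decidable using (_×-dec_; _⊎-dec_; ¬?)
open import Relation.Unary using (Pred; Decidable)
open import Relation.Binary using (tri<; tri≈; tri>)
open import Relation.Binary.PropositionalEquality
  using (_≡_; _≢_; refl; sym; trans; cong; cong₂; subst; subst₂; module ≡-Reasoning)
open import Function using (_∘_; _⇔_; Equivalence)
open import Data.Nat.Tactic.RingSolver using (solve-∀)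

-- Injections avoiding a list of forbidden colours

punchOutList : ∀ {K} (a : Fin (suc K)) → List (Fin (suc K)) → List (Fin K)
punchOutList a [] = []
punchOutList a (b ∷ F) with a Fin.≟ b
... | yes _ = punchOutList a F
... | no a≢b = punchOut a≢b ∷ punchOutList a F

length-punchOutList : ∀ {K} a F → length (punchOutList {K} a F) ≤ length F
length-punchOutList a [] = z≤n
length-punchOutList a (b ∷ F) with a Fin.≟ b
... | yes _ = m≤n⇒m≤1+n (length-punchOutList a F)
... | no _ = s≤s (length-punchOutList a F)

∈-punchOutList : ∀ {K} a F {b} (a≢b : a ≢ b) → b ∈ F → punchOut a≢b ∈ punchOutList {K} a F
∈-punchOutList a (b ∷ F) a≢b (here refl) with a Fin.≟ b
... | yes a≡b = contradiction a≡b a≢b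
... | no _ = here (punchOut-cong a refl)
∈-punchOutList a (c ∷ F) a≢b (there b∈F) with a Fin.≟ c
... | yes _ = ∈-punchOutList a F a≢b b∈F
... | no _ = there (∈-punchOutList a F a≢b b∈F)

punchOutList-room : ∀ {K} (a : Fin (suc K)) F s →
  s + length (a ∷ F) ≤ suc K → s + length (punchOutList a F) ≤ K
punchOutList-room {K} a F s room =
  ℕ.s≤s⁻¹ (≤-trans (s≤s (+-monoʳ-≤ s (length-punchOutList a F)))
                   (subst (_≤ suc K) (+-suc s (length F)) room))

avoiding : ∀ {K} (F : List (Fin K)) s → s + length F ≤ K → Fin s → Fin K
avoiding [] s room j = inject≤ j (subst (_≤ _) (+-identityʳ s) room)
avoiding {suc K} (a ∷ F) s room j =
  punchIn a (avoiding (punchOutList a F) s (punchOutList-room a F s room) j)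

avoiding-injective : ∀ {K} F s room (i j : Fin s) → avoiding {K} F s room i ≡ avoiding F s room j → i ≡ j
avoiding-injective [] s room i j eq =
  toℕ-injective (trans (sym (toℕ-inject≤ i _)) (trans (cong toℕ eq) (toℕ-inject≤ j _)))
avoiding-injective {suc K} (a ∷ F) s room i j eq =
  avoiding-injective (punchOutList a F) s _ i j (punchIn-injective a _ _ eq)

avoiding-∉ : ∀ {K} F s room (j : Fin s) → avoiding {K} F s room j ∉ F
avoiding-∉ {suc K} (a ∷ F) s room j (here eq) = punchInᵢ≢i a _ eq
avoiding-∉ {suc K} (a ∷ F) s room j (there p) =
  avoiding-∉ (punchOutList a F) s _ j
    (subst (_∈ punchOutList a F) (punchOut-punchIn a)
      (∈-punchOutList a F (punchInᵢ≢i a _ ∘ sym) p))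

-- The total version; when there is no room it returns the junk colour zero.
pickAvoiding : ∀ {K} (F : List (Fin (suc K))) s → Fin s → Fin (suc K)
pickAvoiding {K} F s j with s + length F ≤? suc K
... | yes room = avoiding F s room j
... | no _ = zero

pickAvoiding-injective : ∀ {K} (F : List (Fin (suc K))) s → s + length F ≤ suc K →
  ∀ i j → pickAvoiding F s i ≡ pickAvoiding F s j → i ≡ j
pickAvoiding-injective {K} F s room i j eq with s + length F ≤? suc K
... | yes room′ = avoiding-injective F s room′ i j eq
... | no noRoom = contradiction room noRoom

pickAvoiding-∉ : ∀ {K} (F : List (Fin (suc K))) s → s + length F ≤ suc K →
  ∀ j → pickAvoiding F s j ∉ F
pickAvoiding-∉ {K} F s room j with s + length F ≤? suc K
... | yes room′ = avoiding-∉ F s room′ j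
... | no noRoom = contradiction room noRoom

module _ {a p q} {A : Set a} {P : Pred A p} {Q : Pred A q}
         (P? : Decidable P) (Q? : Decidable Q) (P⇒Q : ∀ {x} → P x → Q x) where

  length-filter-mono : ∀ xs → length (filter P? xs) ≤ length (filter Q? xs)
  length-filter-mono [] = z≤n
  length-filter-mono (x ∷ xs) with P? x | Q? x
  ... | yes _ | yes _ = s≤s (length-filter-mono xs)
  ... | yes px | no ¬qx = contradiction (P⇒Q px) ¬qx
  ... | no _ | yes _ = m≤n⇒m≤1+n (length-filter-mono xs)
  ... | no _ | no _ = length-filter-mono xs

  length-filter-mono-< : ∀ {b} xs → b ∈ xs → Q b → ¬ P b →
    length (filter P? xs) < length (filter Q? xs)
  length-filter-mono-< (x ∷ xs) (here refl) qb ¬pb with P? x | Q? x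
  ... | yes pb | _ = contradiction pb ¬pb
  ... | no _ | yes _ = s≤s (length-filter-mono xs)
  ... | no _ | no ¬qb = contradiction qb ¬qb
  length-filter-mono-< (x ∷ xs) (there b∈xs) qb ¬pb with P? x | Q? x
  ... | yes _ | yes _ = s≤s (length-filter-mono-< xs b∈xs qb ¬pb)
  ... | yes px | no ¬qx = contradiction (P⇒Q px) ¬qx
  ... | no _ | yes _ = m≤n⇒m≤1+n (length-filter-mono-< xs b∈xs qb ¬pb)
  ... | no _ | no _ = length-filter-mono-< xs b∈xs qb ¬pb

≤-foldr-⊔ : ∀ {A : Set} (g : A → ℕ) (xs : List A) {x} → x ∈ xs → g x ≤ foldr _⊔_ 0 (List.map g xs)
≤-foldr-⊔ g (y ∷ xs) (here refl) = m≤m⊔n (g y) _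
≤-foldr-⊔ g (y ∷ xs) (there x∈xs) = ≤-trans (≤-foldr-⊔ g xs x∈xs) (m≤n⊔m (g y) _)

cyclicSuc : ℕ → ℕ → ℕ
cyclicSuc L t with suc t <? L
... | yes _ = suc t
... | no _ = 0

cyclicSuc-< : ∀ {L t} → suc t < L → cyclicSuc L t ≡ suc t
cyclicSuc-< {L} {t} t+1<L with suc t <? L
... | yes _ = refl
... | no t+1≮L = contradiction t+1<L t+1≮L

cyclicSuc-last : ∀ {L t} → suc t ≡ L → cyclicSuc L t ≡ 0
cyclicSuc-last {L} {t} t+1≡L with suc t <? L
... | yes t+1<L = contradiction t+1≡L (<⇒≢ t+1<L)
... | no _ = refl

next-cases : ∀ {m} (i : Fin (suc m)) →
  (toℕ i ≡ m × toℕ (next i) ≡ 0) ⊎ (suc (toℕ i) ≤ m × toℕ (next i) ≡ suc (toℕ i))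
next-cases {zero} zero = inj₁ (refl , refl)
next-cases {suc m} zero = inj₂ (s≤s z≤n , refl)
next-cases {suc m} (suc i) with next {m} i | next-cases {m} i
... | zero | inj₁ (i≡m , _) = inj₁ (cong suc i≡m , refl)
... | suc j | inj₂ (i<m , eq) = inj₂ (s≤s i<m , cong suc eq)

toℕ-next : ∀ {m} (i : Fin (suc m)) → toℕ (next i) ≡ cyclicSuc (suc m) (toℕ i)
toℕ-next {m} i with suc (toℕ i) <? suc m | next-cases i
... | yes i<m | inj₁ (i≡m , _) = ⊥-elim (<-irrefl i≡m (ℕ.s≤s⁻¹ i<m))
... | yes _ | inj₂ (_ , eq) = eq
... | no _ | inj₁ (_ , eq) = eq
... | no i≮m | inj₂ (i<m , _) = contradiction (s≤s i<m) i≮m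

next-injective : ∀ {m} {i j : Fin (suc m)} → next i ≡ next j → i ≡ j
next-injective {m} {i} {j} eq with next-cases i | next-cases j
... | inj₁ (i≡m , _) | inj₁ (j≡m , _) = toℕ-injective (trans i≡m (sym j≡m))
... | inj₁ (_ , a) | inj₂ (_ , b) = ⊥-elim (0≢1+n (trans (sym a) (trans (cong toℕ eq) b)))
... | inj₂ (_ , a) | inj₁ (_ , b) = ⊥-elim (0≢1+n (trans (sym b) (trans (cong toℕ (sym eq)) a)))
... | inj₂ (_ , a) | inj₂ (_ , b) = toℕ-injective (suc-injective (trans (sym a) (trans (cong toℕ eq) b)))

prev : ∀ {m} → Fin (suc m) → Fin (suc m)
prev {m} zero = fromℕ m
prev (suc k) = inject₁ k

next-prev : ∀ {m} (i : Fin (suc m)) → next (prev i) ≡ i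
next-prev {m} zero with next-cases (fromℕ m)
... | inj₁ (_ , eq) = toℕ-injective eq
... | inj₂ (m<m , _) = ⊥-elim (<-irrefl (toℕ-fromℕ m) m<m)
next-prev {suc m} (suc k) with next-cases (inject₁ k)
... | inj₁ (k≡m , _) = ⊥-elim (toℕ-inject₁-≢ k (sym k≡m))
... | inj₂ (_ , eq) = toℕ-injective (trans eq (cong suc (toℕ-inject₁ k)))

prev-unique : ∀ {m} {i j : Fin (suc m)} → next j ≡ i → j ≡ prev i
prev-unique {i = i} eq = next-injective (trans eq (sym (next-prev i)))

cyclicSuc²-≢ : ∀ L t → 3 ≤ L → t < L → cyclicSuc L (cyclicSuc L t) ≢ t
cyclicSuc²-≢ L t 3≤L t<L with suc t <? L
... | yes _ with suc (suc t) <? L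
...   | yes _ = λ eq → <-irrefl (sym eq) (m≤n⇒m≤1+n (n<1+n t))
...   | no t+2≮L = λ 0≡t → t+2≮L (≤-trans (s≤s (s≤s (s≤s (≤-reflexive (sym 0≡t))))) 3≤L)
cyclicSuc²-≢ L t 3≤L t<L | no t+1≮L with 1 <? L
... | yes _ = λ 1≡t → t+1≮L (≤-trans (s≤s (s≤s (≤-reflexive (sym 1≡t)))) 3≤L)
... | no 1≮L = contradiction (≤-trans (s≤s (s≤s z≤n)) 3≤L) 1≮L

next²-≢ : ∀ {m} → 2 ≤ m → (j : Fin (suc m)) → next (next j) ≢ j
next²-≢ {m} 2≤m j eq = cyclicSuc²-≢ (suc m) (toℕ j) (s≤s 2≤m) (toℕ<n j)
  (trans (sym (trans (toℕ-next (next j)) (cong (cyclicSuc (suc m)) (toℕ-next j)))) (cong toℕ eq))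

next²-edge : ∀ {m} → m ≡ 1 → (j : Fin (suc m)) → next (next j) ≡ j
next²-edge refl zero = refl
next²-edge refl (suc zero) = refl

-- Star edge colourings of cycles with four colours

mod3 : ℕ → ℕ
mod3 0 = 0
mod3 1 = 1
mod3 2 = 2
mod3 (suc (suc (suc n))) = mod3 n

mod4 : ℕ → ℕ
mod4 0 = 0
mod4 1 = 1
mod4 2 = 2
mod4 3 = 3
mod4 (suc (suc (suc (suc n)))) = mod4 n

mod3<3 : ∀ n → mod3 n < 3
mod3<3 0 = s≤s z≤n
mod3<3 1 = s≤s (s≤s z≤n)
mod3<3 2 = s≤s (s≤s (s≤s z≤n))
mod3<3 (suc (suc (suc n))) = mod3<3 n

mod4<4 : ∀ n → mod4 n < 4
mod4<4 0 = s≤s z≤n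
mod4<4 1 = s≤s (s≤s z≤n)
mod4<4 2 = s≤s (s≤s (s≤s z≤n))
mod4<4 3 = s≤s (s≤s (s≤s (s≤s z≤n)))
mod4<4 (suc (suc (suc (suc n)))) = mod4<4 n

mod3-suc-≢ : ∀ t → mod3 (suc t) ≢ mod3 t
mod3-suc-≢ 0 ()
mod3-suc-≢ 1 ()
mod3-suc-≢ 2 ()
mod3-suc-≢ (suc (suc (suc t))) = mod3-suc-≢ t

mod3-suc²-≢ : ∀ t → mod3 (suc (suc t)) ≢ mod3 t
mod3-suc²-≢ 0 ()
mod3-suc²-≢ 1 ()
mod3-suc²-≢ 2 ()
mod3-suc²-≢ (suc (suc (suc t))) = mod3-suc²-≢ t

mod4-suc-≢ : ∀ t → mod4 (suc t) ≢ mod4 t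
mod4-suc-≢ 0 ()
mod4-suc-≢ 1 ()
mod4-suc-≢ 2 ()
mod4-suc-≢ 3 ()
mod4-suc-≢ (suc (suc (suc (suc t)))) = mod4-suc-≢ t

mod4-suc²-≢ : ∀ t → mod4 (suc (suc t)) ≢ mod4 t
mod4-suc²-≢ 0 ()
mod4-suc²-≢ 1 ()
mod4-suc²-≢ 2 ()
mod4-suc²-≢ 3 ()
mod4-suc²-≢ (suc (suc (suc (suc t)))) = mod4-suc²-≢ t

mod3-+3* : ∀ r c → mod3 (r + 3 * c) ≡ mod3 r
mod3-+3* r zero = cong mod3 (+-identityʳ r)
mod3-+3* r (suc c) = trans (cong mod3 (shift r c)) (mod3-+3* r c)
  where
  shift : ∀ r c → r + 3 * suc c ≡ 3 + (r + 3 * c)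
  shift = solve-∀

mod4-+4* : ∀ r a → mod4 (r + 4 * a) ≡ mod4 r
mod4-+4* r zero = cong mod4 (+-identityʳ r)
mod4-+4* r (suc a) = trans (cong mod4 (shift r a)) (mod4-+4* r a)
  where
  shift : ∀ r a → r + 4 * suc a ≡ 4 + (r + 4 * a)
  shift = solve-∀

mod4-last : ∀ a t → suc t ≡ 4 * a → mod4 t ≡ 3
mod4-last zero t ()
mod4-last (suc a) t eq = trans (cong mod4 (suc-injective (trans eq (split a)))) (mod4-+4* 3 a)
  where
  split : ∀ a → 4 * suc a ≡ suc (3 + 4 * a)
  split = solve-∀

mod4-penultimate : ∀ a t → suc (suc t) ≡ 4 * a → mod4 t ≡ 2
mod4-penultimate zero t ()
mod4-penultimate (suc a) t eq =
  trans (cong mod4 (suc-injective (suc-injective (trans eq (split a))))) (mod4-+4* 2 a)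
  where
  split : ∀ a → 4 * suc a ≡ suc (suc (2 + 4 * a))
  split = solve-∀

blockColour : ℕ → ℕ → ℕ
blockColour a t with t <? 4 * a
... | yes _ = mod4 t
... | no _ = mod3 (t ∸ 4 * a)

blockColour-below : ∀ a t → t < 4 * a → blockColour a t ≡ mod4 t
blockColour-below a t t<4a with t <? 4 * a
... | yes _ = refl
... | no t≮4a = contradiction t<4a t≮4a

blockColour-above : ∀ a t → 4 * a ≤ t → blockColour a t ≡ mod3 (t ∸ 4 * a)
blockColour-above a t 4a≤t with t <? 4 * a
... | yes t<4a = contradiction 4a≤t (<⇒≱ t<4a)
... | no _ = refl

blockColour<4 : ∀ a t → blockColour a t < 4
blockColour<4 a t with t <? 4 * a
... | yes _ = mod4<4 t
... | no _ = m≤n⇒m≤1+n (mod3<3 (t ∸ 4 * a))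

blockColour-0 : ∀ a → blockColour a 0 ≡ 0
blockColour-0 zero = refl
blockColour-0 (suc a) = refl

blockColour-1 : ∀ a → blockColour a 1 ≡ 1
blockColour-1 zero = refl
blockColour-1 (suc a) = blockColour-below (suc a) 1 (≤-trans (s≤s (s≤s z≤n)) (*-monoʳ-≤ 4 (s≤s (z≤n {a}))))

blockColour-suc-≢ : ∀ a t → blockColour a (suc t) ≢ blockColour a t
blockColour-suc-≢ a t with <-cmp (suc t) (4 * a)
... | tri< t+1<4a _ _ =
  subst₂ _≢_ (sym (blockColour-below a (suc t) t+1<4a))
             (sym (blockColour-below a t (<-trans (n<1+n t) t+1<4a))) (mod4-suc-≢ t)
... | tri≈ _ t+1≡4a _ =
  subst₂ _≢_ (sym (trans (blockColour-above a (suc t) (≤-reflexive (sym t+1≡4a)))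
                         (cong mod3 (m≤n⇒m∸n≡0 (≤-reflexive t+1≡4a)))))
             (sym (trans (blockColour-below a t (≤-reflexive t+1≡4a)) (mod4-last a t t+1≡4a)))
             (λ ())
... | tri> _ _ 4a<t+1 =
  subst₂ _≢_ (sym (trans (blockColour-above a (suc t) (m≤n⇒m≤1+n 4a≤t))
                         (cong mod3 (+-∸-assoc 1 4a≤t))))
             (sym (blockColour-above a t 4a≤t)) (mod3-suc-≢ (t ∸ 4 * a))
  where
  4a≤t = ℕ.s≤s⁻¹ 4a<t+1

blockColour-suc²-≢ : ∀ a t → blockColour a (suc (suc t)) ≢ blockColour a t
blockColour-suc²-≢ a t with <-cmp (suc (suc t)) (4 * a)
... | tri< t+2<4a _ _ =
  subst₂ _≢_ (sym (blockColour-below a (suc (suc t)) t+2<4a))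
             (sym (blockColour-below a t (<-trans (m<n+m t (s≤s z≤n)) t+2<4a))) (mod4-suc²-≢ t)
... | tri≈ _ t+2≡4a _ =
  subst₂ _≢_ (sym (trans (blockColour-above a (suc (suc t)) (≤-reflexive (sym t+2≡4a)))
                         (cong mod3 (m≤n⇒m∸n≡0 (≤-reflexive t+2≡4a)))))
             (sym (trans (blockColour-below a t (≤-trans (n≤1+n (suc t)) (≤-reflexive t+2≡4a)))
                         (mod4-penultimate a t t+2≡4a)))
             (λ ())
... | tri> _ _ 4a<t+2 with 4 * a ≤? t
...   | yes 4a≤t =
  subst₂ _≢_ (sym (trans (blockColour-above a (suc (suc t)) (≤-trans 4a≤t (m≤n+m t 2)))
                         (cong mod3 (+-∸-assoc 2 4a≤t))))
             (sym (blockColour-above a t 4a≤t)) (mod3-suc²-≢ (t ∸ 4 * a))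
...   | no 4a≰t =
  subst₂ _≢_ (sym (trans (blockColour-above a (suc (suc t)) (ℕ.<⇒≤ 4a<t+2))
                         (cong mod3 (trans (cong (suc (suc t) ∸_) (sym t+1≡4a)) (m+n∸n≡m 1 t)))))
             (sym (trans (blockColour-below a t (≤-reflexive t+1≡4a)) (mod4-last a t t+1≡4a)))
             (λ ())
  where
  t+1≡4a : suc t ≡ 4 * a
  t+1≡4a = ≤-antisym (≰⇒> 4a≰t) (ℕ.s≤s⁻¹ 4a<t+2)

blockColour-last : ∀ a c t → suc t ≡ 4 * a + 3 * c → 2 ≤ blockColour a t
blockColour-last a zero t eq =
  subst (2 ≤_) (sym (trans (blockColour-below a t (≤-reflexive eq′)) (mod4-last a t eq′))) (s≤s (s≤s z≤n))
  where
  eq′ = trans eq (+-identityʳ (4 * a))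
blockColour-last a (suc c) t eq =
  subst (2 ≤_) (sym (trans (blockColour-above a t (subst (4 * a ≤_) (sym t≡) (m≤m+n _ _)))
                           (trans (cong mod3 (trans (cong (_∸ 4 * a) t≡) (m+n∸m≡n (4 * a) _)))
                                  (mod3-+3* 2 c))))
        (s≤s (s≤s z≤n))
  where
  split : ∀ a c → 4 * a + 3 * suc c ≡ suc (4 * a + (2 + 3 * c))
  split = solve-∀
  t≡ : t ≡ 4 * a + (2 + 3 * c)
  t≡ = suc-injective (trans eq (split a c))

blockColour-penultimate : ∀ a c t → suc (suc t) ≡ 4 * a + 3 * c → blockColour a t ≢ 0
blockColour-penultimate a zero t eq =
  subst (_≢ 0) (sym (trans (blockColour-below a t (≤-trans (n≤1+n (suc t)) (≤-reflexive eq′)))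
                           (mod4-penultimate a t eq′)))
        (λ ())
  where
  eq′ = trans eq (+-identityʳ (4 * a))
blockColour-penultimate a (suc c) t eq =
  subst (_≢ 0) (sym (trans (blockColour-above a t (subst (4 * a ≤_) (sym t≡) (m≤m+n _ _)))
                           (trans (cong mod3 (trans (cong (_∸ 4 * a) t≡) (m+n∸m≡n (4 * a) _)))
                                  (mod3-+3* 1 c))))
        (λ ())
  where
  split : ∀ a c → 4 * a + 3 * suc c ≡ suc (suc (4 * a + (1 + 3 * c)))
  split = solve-∀
  t≡ : t ≡ 4 * a + (1 + 3 * c)
  t≡ = suc-injective (suc-injective (trans eq (split a c)))

blockColour-cyclicSuc-≢ : ∀ a c t → t < 4 * a + 3 * c →
  blockColour a (cyclicSuc (4 * a + 3 * c) t) ≢ blockColour a t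
blockColour-cyclicSuc-≢ a c t t<L with <-cmp (suc t) (4 * a + 3 * c)
... | tri< t+1<L _ _ = subst (λ x → blockColour a x ≢ _) (sym (cyclicSuc-< t+1<L)) (blockColour-suc-≢ a t)
... | tri≈ _ t+1≡L _ = λ eq →
  <-irrefl (trans (sym (trans (cong (blockColour a) (cyclicSuc-last t+1≡L)) (blockColour-0 a))) eq)
           (≤-trans (s≤s z≤n) (blockColour-last a c t t+1≡L))
... | tri> _ _ t+1>L = contradiction t<L (<⇒≱ t+1>L)

blockColour-cyclicSuc²-≢ : ∀ a c t → 3 ≤ 4 * a + 3 * c → t < 4 * a + 3 * c →
  blockColour a (cyclicSuc (4 * a + 3 * c) (cyclicSuc (4 * a + 3 * c) t)) ≢ blockColour a t
blockColour-cyclicSuc²-≢ a c t 3≤L t<L with <-cmp (suc t) (4 * a + 3 * c)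
... | tri> _ _ t+1>L = contradiction t<L (<⇒≱ t+1>L)
... | tri≈ _ t+1≡L _ = λ eq →
  <-irrefl (trans (sym (trans (cong (blockColour a) (trans (cong (cyclicSuc _) (cyclicSuc-last t+1≡L))
                                                          (cyclicSuc-< (≤-trans (s≤s (s≤s z≤n)) 3≤L))))
                              (blockColour-1 a))) eq)
           (blockColour-last a c t t+1≡L)
... | tri< t+1<L _ _ with <-cmp (suc (suc t)) (4 * a + 3 * c)
...   | tri< t+2<L _ _ =
  subst (λ x → blockColour a x ≢ _) (sym (trans (cong (cyclicSuc _) (cyclicSuc-< t+1<L)) (cyclicSuc-< t+2<L)))
        (blockColour-suc²-≢ a t)
...   | tri≈ _ t+2≡L _ = λ eq →
  blockColour-penultimate a c t t+2≡L
    (trans (sym eq) (trans (cong (blockColour a) (trans (cong (cyclicSuc _) (cyclicSuc-< t+1<L)) (cyclicSuc-last t+2≡L)))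
                           (blockColour-0 a)))
...   | tri> _ _ t+2>L = contradiction t+1<L (<⇒≱ t+2>L)

sumOfFoursAndThrees : ∀ L → 3 ≤ L → L ≢ 5 → ∃[ a ] ∃[ c ] 4 * a + 3 * c ≡ L
sumOfFoursAndThrees 0 () _
sumOfFoursAndThrees 1 (s≤s ()) _
sumOfFoursAndThrees 2 (s≤s (s≤s ())) _
sumOfFoursAndThrees 3 _ _ = 0 , 1 , refl
sumOfFoursAndThrees 4 _ _ = 1 , 0 , refl
sumOfFoursAndThrees 5 _ L≢5 = ⊥-elim (L≢5 refl)
sumOfFoursAndThrees 6 _ _ = 0 , 2 , refl
sumOfFoursAndThrees 7 _ _ = 1 , 1 , refl
sumOfFoursAndThrees 8 _ _ = 2 , 0 , refl
sumOfFoursAndThrees (suc (suc (suc (suc (suc (suc (suc (suc (suc k))))))))) _ _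
  with sumOfFoursAndThrees (6 + k) (s≤s (s≤s (s≤s z≤n))) (λ ())
... | a , c , eq = a , suc c , trans (shift a c) (cong (3 +_) eq)
  where
  shift : ∀ a c → 4 * a + 3 * suc c ≡ 3 + (4 * a + 3 * c)
  shift = solve-∀

pentagonColour : ℕ → ℕ
pentagonColour 0 = 0
pentagonColour 1 = 1
pentagonColour 2 = 2
pentagonColour 3 = 0
pentagonColour _ = 3

-- For L < 3 the value is the junk colour 0, which is also right for a single edge (L = 2).
cycleColour : ℕ → ℕ → ℕ
cycleColour L t with 3 ≤? L | L ℕ.≟ 5
... | _ | yes _ = pentagonColour t
... | yes 3≤L | no L≢5 = blockColour (proj₁ (sumOfFoursAndThrees L 3≤L L≢5)) t
... | no _ | no _ = 0

cycleColour-edge : ∀ {m} → m ≡ 1 → ∀ t t′ → cycleColour (suc m) t ≡ cycleColour (suc m) t′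
cycleColour-edge refl t t′ = refl

cycleColour<4 : ∀ L t → cycleColour L t < 4
cycleColour<4 L t with 3 ≤? L | L ℕ.≟ 5
... | _ | yes _ = pentagonColour<4 t
  where
  pentagonColour<4 : ∀ t → pentagonColour t < 4
  pentagonColour<4 0 = s≤s z≤n
  pentagonColour<4 1 = s≤s (s≤s z≤n)
  pentagonColour<4 2 = s≤s (s≤s (s≤s z≤n))
  pentagonColour<4 3 = s≤s z≤n
  pentagonColour<4 (suc (suc (suc (suc _)))) = s≤s (s≤s (s≤s (s≤s z≤n)))
... | yes 3≤L | no L≢5 = blockColour<4 (proj₁ (sumOfFoursAndThrees L 3≤L L≢5)) t
... | no _ | no _ = s≤s z≤n

cycleColour-cyclicSuc-≢ : ∀ L t → 3 ≤ L → t < L → cycleColour L (cyclicSuc L t) ≢ cycleColour L t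
cycleColour-cyclicSuc-≢ L t 3≤L t<L with 3 ≤? L | L ℕ.≟ 5
... | no 3≰L | _ = contradiction 3≤L 3≰L
... | yes _ | yes refl = pentagon t t<L
  where
  pentagon : ∀ t → t < 5 → pentagonColour (cyclicSuc 5 t) ≢ pentagonColour t
  pentagon 0 _ ()
  pentagon 1 _ ()
  pentagon 2 _ ()
  pentagon 3 _ ()
  pentagon 4 _ ()
... | yes 3≤L′ | no L≢5 with sumOfFoursAndThrees L 3≤L′ L≢5
... | a , c , refl = blockColour-cyclicSuc-≢ a c t t<L

cycleColour-no-bicoloured : ∀ L t → 3 ≤ L → t < L →
  let t₁ = cyclicSuc L t ; t₂ = cyclicSuc L t₁ ; t₃ = cyclicSuc L t₂ in
  ¬ (cycleColour L t ≡ cycleColour L t₂ × cycleColour L t₁ ≡ cycleColour L t₃)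
cycleColour-no-bicoloured L t 3≤L t<L with 3 ≤? L | L ℕ.≟ 5
... | no 3≰L | _ = contradiction 3≤L 3≰L
... | yes _ | yes refl = pentagon t t<L
  where
  pentagon : ∀ t → t < 5 →
    let t₁ = cyclicSuc 5 t ; t₂ = cyclicSuc 5 t₁ ; t₃ = cyclicSuc 5 t₂ in
    ¬ (pentagonColour t ≡ pentagonColour t₂ × pentagonColour t₁ ≡ pentagonColour t₃)
  pentagon 0 _ (() , _)
  pentagon 1 _ (() , _)
  pentagon 2 _ (() , _)
  pentagon 3 _ (_ , ())
  pentagon 4 _ (() , _)
... | yes 3≤L′ | no L≢5 with sumOfFoursAndThrees L 3≤L′ L≢5
... | a , c , refl = λ (t≡t₂ , _) → blockColour-cyclicSuc²-≢ a c t 3≤L t<L (sym t≡t₂)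

-- Half-turn windows on a cycle

n≤1+[n/2]*2 : ∀ n → n ≤ suc (n / 2 * 2)
n≤1+[n/2]*2 n =
  subst (_≤ suc (n / 2 * 2)) (sym (m≡m%n+[m/n]*n n 2)) (+-monoˡ-≤ (n / 2 * 2) (ℕ.s≤s⁻¹ (m%n<n n 2)))

withinHalfTurn : ∀ T .{{_ : ℕ.NonZero T}} a δ → 0 < δ → a + δ < T →
  (∃[ d ] d < T / 2 × (a + suc d) % T ≡ a + δ) ⊎ (∃[ d ] d < T / 2 × (a + δ + suc d) % T ≡ a)
withinHalfTurn T a δ 0<δ a+δ<T with δ ≤? T / 2
... | yes δ≤T/2 =
  inj₁ (δ ∸ 1 , subst (_≤ T / 2) (sym suc[δ∸1]≡δ) δ≤T/2 ,
        trans (cong (λ x → (a + x) % T) suc[δ∸1]≡δ) (m<n⇒m%n≡m a+δ<T))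
  where
  suc[δ∸1]≡δ = m+[n∸m]≡n 0<δ
... | no δ≰T/2 =
  inj₂ (T ∸ δ ∸ 1 , subst (_≤ T / 2) (sym suc[T∸δ∸1]≡T∸δ) T∸δ≤T/2 ,
        trans (cong (_% T) (trans (cong (a + δ +_) suc[T∸δ∸1]≡T∸δ) round))
              (trans ([m+n]%n≡m%n a T) (m<n⇒m%n≡m (≤-trans (m≤m+n (suc a) δ) a+δ<T))))
  where
  δ≤T : δ ≤ T
  δ≤T = ≤-trans (m≤n+m δ a) (<⇒≤ a+δ<T)
  suc[T∸δ∸1]≡T∸δ = m+[n∸m]≡n (m<n⇒0<n∸m (≤-trans (m≤n+m (suc δ) a) (subst (_≤ T) (sym (+-suc a δ)) a+δ<T)))
  round : a + δ + (T ∸ δ) ≡ a + T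
  round = trans (+-assoc a δ (T ∸ δ)) (cong (a +_) (m+[n∸m]≡n δ≤T))
  T∸δ≤T/2 : T ∸ δ ≤ T / 2
  T∸δ≤T/2 = begin
    T ∸ δ                     ≤⟨ ∸-monoʳ-≤ T (≰⇒> δ≰T/2) ⟩
    T ∸ suc (T / 2)           ≤⟨ ∸-monoˡ-≤ (suc (T / 2)) (n≤1+[n/2]*2 T) ⟩
    suc (T / 2 * 2) ∸ suc (T / 2) ≡⟨ cong (_∸ T / 2) (*-comm (T / 2) 2) ⟩
    2 * (T / 2) ∸ T / 2           ≡⟨ m+n∸m≡n (T / 2) (T / 2 + 0) ⟩
    T / 2 + 0                     ≡⟨ +-identityʳ (T / 2) ⟩
    T / 2                         ∎
    where open ≤-Reasoning

cyclicWindow : ∀ {A : Set} t → (Fin t → A) → Fin t → List A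
cyclicWindow (suc t) P ρ =
  map (λ d → P (fromℕ< (m%n<n (toℕ ρ + suc d) (suc t)))) (upTo (suc t / 2))

length-cyclicWindow : ∀ {A : Set} t (P : Fin t → A) ρ → length (cyclicWindow t P ρ) ≡ t / 2
length-cyclicWindow (suc t) P ρ = trans (length-map _ (upTo (suc t / 2))) (length-upTo _)

∈-cyclicWindow : ∀ {A : Set} t (P : Fin (suc t) → A) (ρ σ : Fin (suc t)) d → d < suc t / 2 →
  (toℕ ρ + suc d) % suc t ≡ toℕ σ → P σ ∈ cyclicWindow (suc t) P ρ
∈-cyclicWindow t P ρ σ d d<t/2 eq =
  subst (λ x → P x ∈ cyclicWindow (suc t) P ρ) (toℕ-injective (trans (toℕ-fromℕ< _) eq))
    (∈-map⁺ (λ d → P (fromℕ< (m%n<n (toℕ ρ + suc d) (suc t)))) (∈-upTo⁺ d<t/2))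

cyclicWindow-either-< : ∀ {A : Set} t (P : Fin (suc t) → A) (ρ σ : Fin (suc t)) → toℕ ρ < toℕ σ →
  P σ ∈ cyclicWindow (suc t) P ρ ⊎ P ρ ∈ cyclicWindow (suc t) P σ
cyclicWindow-either-< t P ρ σ ρ<σ =
  Sum.map (λ (d , d<t/2 , eq) → ∈-cyclicWindow t P ρ σ d d<t/2 (trans eq ρ+δ≡σ))
          (λ (d , d<t/2 , eq) → ∈-cyclicWindow t P σ ρ d d<t/2
                                   (subst (λ x → (x + suc d) % suc t ≡ toℕ ρ) ρ+δ≡σ eq))
          (withinHalfTurn (suc t) (toℕ ρ) (toℕ σ ∸ toℕ ρ) (m<n⇒0<n∸m ρ<σ)
                          (subst (_< suc t) (sym ρ+δ≡σ) (toℕ<n σ)))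
  where
  ρ+δ≡σ : toℕ ρ + (toℕ σ ∸ toℕ ρ) ≡ toℕ σ
  ρ+δ≡σ = m+[n∸m]≡n (<⇒≤ ρ<σ)

cyclicWindow-either : ∀ {A : Set} t (P : Fin t → A) (ρ σ : Fin t) → ρ ≢ σ →
  P σ ∈ cyclicWindow t P ρ ⊎ P ρ ∈ cyclicWindow t P σ
cyclicWindow-either (suc t) P ρ σ ρ≢σ with <-cmp (toℕ ρ) (toℕ σ)
... | tri< ρ<σ _ _ = cyclicWindow-either-< t P ρ σ ρ<σ
... | tri≈ _ ρ≡σ _ = ⊥-elim (ρ≢σ (toℕ-injective ρ≡σ))
... | tri> _ _ σ<ρ = Sum.swap (cyclicWindow-either-< t P σ ρ σ<ρ)

-- The number of cycle edges at a vertex of a cycle of length L, and the number of colours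
-- used on such a cycle (L = 2 encodes a single edge).
cycleDegree : ℕ → ℕ
cycleDegree 2 = 1
cycleDegree _ = 2

paletteSize : ℕ → ℕ
paletteSize 2 = 1
paletteSize _ = 4

edgeOrCycle : ∀ m → 1 ≤ m → m ≡ 1 ⊎ 2 ≤ m
edgeOrCycle (suc zero) _ = inj₁ refl
edgeOrCycle (suc (suc m)) _ = inj₂ (s≤s (s≤s z≤n))

cycleDegree-cycle : ∀ {m} → 2 ≤ m → cycleDegree (suc m) ≡ 2
cycleDegree-cycle (s≤s (s≤s _)) = refl

paletteSize-cycle : ∀ {m} → 2 ≤ m → paletteSize (suc m) ≡ 4
paletteSize-cycle (s≤s (s≤s _)) = refl

cycleDegree≤2 : ∀ L → cycleDegree L ≤ 2
cycleDegree≤2 0 = ≤-refl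
cycleDegree≤2 1 = ≤-refl
cycleDegree≤2 2 = s≤s z≤n
cycleDegree≤2 (suc (suc (suc _))) = ≤-refl

cycleColour<paletteSize : ∀ L t → cycleColour L t < paletteSize L
cycleColour<paletteSize 0 t = cycleColour<4 0 t
cycleColour<paletteSize 1 t = cycleColour<4 1 t
cycleColour<paletteSize 2 t = s≤s z≤n
cycleColour<paletteSize (suc (suc (suc L))) t = cycleColour<4 (3 + L) t

3*n/2≡n+n/2 : ∀ n → 3 * n / 2 ≡ n + n / 2
3*n/2≡n+n/2 n = begin
  3 * n / 2             ≡⟨ cong (_/ 2) (split n) ⟩
  (n * 2 + n) / 2       ≡⟨ +-distrib-/ (n * 2) n (subst (λ x → x + n % 2 < 2) (sym (m*n%n≡0 n 2)) (m%n<n n 2)) ⟩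
  n * 2 / 2 + n / 2     ≡⟨ cong (_+ n / 2) (m*n/n≡m n 2) ⟩
  n + n / 2             ∎
  where
  open ≡-Reasoning
  split : ∀ n → 3 * n ≡ n * 2 + n
  split = solve-∀

c+t/2≤1+[c+t]/2 : ∀ c t → c ≤ 2 → c + t / 2 ≤ suc ((c + t) / 2)
c+t/2≤1+[c+t]/2 0 t _ = n≤1+n (t / 2)
c+t/2≤1+[c+t]/2 1 t _ = s≤s (/-monoˡ-≤ 2 (n≤1+n t))
c+t/2≤1+[c+t]/2 2 t _ = ≤-reflexive (cong suc (sym (m/n≡1+[m∸n]/n {2 + t} {2} (s≤s (s≤s z≤n)))))
c+t/2≤1+[c+t]/2 (suc (suc (suc _))) t (s≤s (s≤s ()))

-- The t children of a cycle vertex, coloured outside the palette of the cycle.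
paletteRoom : ∀ L t Δ → t + cycleDegree L ≤ Δ → t + paletteSize L ≤ suc (3 * Δ / 2)
paletteRoom L t Δ t+c≤Δ = subst (t + paletteSize L ≤_) (cong suc (sym (3*n/2≡n+n/2 Δ))) (room L t+c≤Δ)
  where
  open ≤-Reasoning
  large : t + 2 ≤ Δ → t + 4 ≤ suc (Δ + Δ / 2)
  large t+2≤Δ = begin
    t + 4           ≡⟨ +-comm t 4 ⟩
    2 + (2 + t)     ≤⟨ +-monoʳ-≤ 2 (subst (_≤ Δ) (+-comm t 2) t+2≤Δ) ⟩
    2 + Δ           ≡⟨ cong suc (+-comm 1 Δ) ⟩
    suc (Δ + 1)     ≤⟨ s≤s (+-monoʳ-≤ Δ (/-monoˡ-≤ 2 (≤-trans (m≤n+m 2 t) t+2≤Δ))) ⟩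
    suc (Δ + Δ / 2) ∎
  room : ∀ L → t + cycleDegree L ≤ Δ → t + paletteSize L ≤ suc (Δ + Δ / 2)
  room 0 = large
  room 1 = large
  room 2 t+1≤Δ = ≤-trans t+1≤Δ (≤-trans (m≤m+n Δ (Δ / 2)) (n≤1+n _))
  room (suc (suc (suc _))) = large

-- The s children of a child u of a cycle vertex r with t children, avoiding the cycleDegree L
-- cycle colours at r, the colour of {u , r} and t / 2 window colours.
windowRoom : ∀ L s t Δ → suc s ≤ Δ → t + cycleDegree L ≤ Δ →
  s + (cycleDegree L + suc (t / 2)) ≤ suc (3 * Δ / 2)
windowRoom L s t Δ s<Δ t+c≤Δ = begin
  s + (c + suc (t / 2))   ≡⟨ shuffle s c (t / 2) ⟩
  suc s + (c + t / 2)     ≤⟨ +-mono-≤ s<Δ (c+t/2≤1+[c+t]/2 c t (cycleDegree≤2 L)) ⟩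
  Δ + suc ((c + t) / 2)   ≤⟨ +-monoʳ-≤ Δ (s≤s (/-monoˡ-≤ 2 (subst (_≤ Δ) (+-comm t c) t+c≤Δ))) ⟩
  Δ + suc (Δ / 2)         ≡⟨ +-suc Δ (Δ / 2) ⟩
  suc (Δ + Δ / 2)         ≡⟨ cong suc (sym (3*n/2≡n+n/2 Δ)) ⟩
  suc (3 * Δ / 2)         ∎
  where
  open ≤-Reasoning
  c = cycleDegree L
  shuffle : ∀ s c h → s + (c + suc h) ≡ suc s + (c + h)
  shuffle = solve-∀

-- The colouring of a unicyclic cactus

bicoloured-alternates : ∀ {A : Set} {a b x y z w : A} →
  (x ≡ a ⊎ x ≡ b) → (y ≡ a ⊎ y ≡ b) → (z ≡ a ⊎ z ≡ b) → (w ≡ a ⊎ w ≡ b) →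
  x ≢ y → y ≢ z → z ≢ w → x ≡ z × y ≡ w
bicoloured-alternates (inj₁ x) (inj₁ y) _ _ x≢y _ _ = ⊥-elim (x≢y (trans x (sym y)))
bicoloured-alternates (inj₂ x) (inj₂ y) _ _ x≢y _ _ = ⊥-elim (x≢y (trans x (sym y)))
bicoloured-alternates _ (inj₁ y) (inj₁ z) _ _ y≢z _ = ⊥-elim (y≢z (trans y (sym z)))
bicoloured-alternates _ (inj₂ y) (inj₂ z) _ _ y≢z _ = ⊥-elim (y≢z (trans y (sym z)))
bicoloured-alternates _ _ (inj₁ z) (inj₁ w) _ _ z≢w = ⊥-elim (z≢w (trans z (sym w)))
bicoloured-alternates _ _ (inj₂ z) (inj₂ w) _ _ z≢w = ⊥-elim (z≢w (trans z (sym w)))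
bicoloured-alternates (inj₁ x) (inj₂ y) (inj₁ z) (inj₂ w) _ _ _ = trans x (sym z) , trans y (sym w)
bicoloured-alternates (inj₂ x) (inj₁ y) (inj₂ z) (inj₁ w) _ _ _ = trans x (sym z) , trans y (sym w)

module UCCColouring {n} (G : Graph n) (U : UCCData n)
                    (G≅U : ∀ u v → Adj G u v ⇔ UCCData.UAdj U u v) where

  open UCCData U
  open import Data.List.Membership.DecPropositional (Fin._≟_ {n}) using (_∈?_)

  onC? : ∀ v → Dec (OnC v)
  onC? v = any? (λ i → cyc i Fin.≟ v)

  -- Every edge of the cactus is {v , up v}: up is the cycle successor on C and the parent off C.
  -- up and κ are opaque so that later with-abstractions over onC? do not reach into them.
  opaque
    up : Fin n → Fin n
    up v with onC? v
    ... | yes (i , _) = cyc (next i)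
    ... | no _ = parent v

    up-cyc : ∀ i → up (cyc i) ≡ cyc (next i)
    up-cyc i with onC? (cyc i)
    ... | yes (j , cyc-j≡cyc-i) = cong (cyc ∘ next) (cyc-inj cyc-j≡cyc-i)
    ... | no ¬on = contradiction (i , refl) ¬on

    up-off : ∀ {v} → ¬ OnC v → up v ≡ parent v
    up-off {v} ¬on with onC? v
    ... | yes on = contradiction on ¬on
    ... | no _ = refl

  OnC-up : ∀ {v} → OnC v → OnC (up v)
  OnC-up (i , refl) = next i , sym (up-cyc i)

  OnC-up² : ∀ v → OnC (up (up v))
  OnC-up² v with onC? v
  ... | yes on = OnC-up (OnC-up on)
  ... | no ¬on with onC? (parent v) | height≤2 v ¬on
  ...   | yes on₁ | _ = OnC-up (subst OnC (sym (up-off ¬on)) on₁)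
  ...   | no ¬on₁ | inj₁ on₁ = contradiction on₁ ¬on₁
  ...   | no ¬on₁ | inj₂ on₂ = subst OnC (sym (trans (cong up (up-off ¬on)) (up-off ¬on₁))) on₂

  UAdj⇒up : ∀ {u v} → UAdj u v → up u ≡ v ⊎ up v ≡ u
  UAdj⇒up (inj₁ (i , inj₁ (refl , refl))) = inj₁ (up-cyc i)
  UAdj⇒up (inj₁ (i , inj₂ (refl , refl))) = inj₂ (up-cyc i)
  UAdj⇒up (inj₂ (inj₁ (¬on , refl))) = inj₁ (up-off ¬on)
  UAdj⇒up (inj₂ (inj₂ (¬on , refl))) = inj₂ (up-off ¬on)

  up⇒UAdj : ∀ {u v} → up u ≡ v → UAdj u v
  up⇒UAdj {u} up-u≡v with onC? u
  ... | yes (i , refl) = inj₁ (i , inj₁ (refl , trans (sym (up-cyc i)) up-u≡v))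
  ... | no ¬on = inj₂ (inj₁ (¬on , trans (sym (up-off ¬on)) up-u≡v))

  Adj⇒up : ∀ {u v} → Adj G u v → up u ≡ v ⊎ up v ≡ u
  Adj⇒up {u} {v} = UAdj⇒up ∘ Equivalence.to (G≅U u v)

  Adj-up : ∀ {u v} → up u ≡ v → Adj G u v
  Adj-up {u} {v} = Equivalence.from (G≅U u v) ∘ up⇒UAdj

  Adj-down : ∀ {u v} → up v ≡ u → Adj G u v
  Adj-down = Graph.sym G ∘ Adj-up

  shape : m ≡ 1 ⊎ 2 ≤ m
  shape = edgeOrCycle m (ℕ.s≤s⁻¹ 2≤m)

  IsChild : Fin n → Fin n → Set
  IsChild x w = up w ≡ x × ¬ OnC w

  isChild? : ∀ x w → Dec (IsChild x w)
  isChild? x w = (up w Fin.≟ x) ×-dec ¬? (onC? w)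

  children : Fin n → List (Fin n)
  children x = filter (isChild? x) (allFin n)

  ∈-children : ∀ {x w} → up w ≡ x → ¬ OnC w → w ∈ children x
  ∈-children {x} {w} up-w≡x ¬on = ∈-filter⁺ (isChild? x) (∈-allFin w) (up-w≡x , ¬on)

  index-injective : ∀ {x w w′} (p : w ∈ children x) (p′ : w′ ∈ children x) →
    Any.index p ≡ Any.index p′ → w ≡ w′
  index-injective {x} p p′ eq =
    trans (lookup-index p) (trans (cong (List.lookup (children x)) eq) (sym (lookup-index p′)))

  IsChild⇒Adj : ∀ {x w} → IsChild x w → Adj G x w
  IsChild⇒Adj (up-w≡x , _) = Adj-down up-w≡x

  Δ : ℕ
  Δ = maxDegree G

  degree≤Δ : ∀ v → degree G v ≤ Δ
  degree≤Δ v = ≤-foldr-⊔ (degree G) (allFin n) (∈-allFin v)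

  children<degree : ∀ {u} → OnC (up u) → length (children u) < degree G u
  children<degree {u} on =
    length-filter-mono-< (isChild? u) (adj? G u) IsChild⇒Adj (allFin n) (∈-allFin (up u))
      (Adj-up refl) (λ (_ , ¬on) → ¬on on)

  children+cycleDegree≤degree : ∀ i → length (children (cyc i)) + cycleDegree (suc m) ≤ degree G (cyc i)
  children+cycleDegree≤degree i with shape
  ... | inj₁ refl = subst (_≤ degree G r) (+-comm 1 _) children<degree′
    where
    r = cyc i
    children<degree′ = children<degree (subst OnC (sym (up-cyc i)) (next i , refl))
  ... | inj₂ 2≤m′ = subst (λ c → length (children r) + c ≤ degree G r) (sym (cycleDegree-cycle 2≤m′))
                          (subst (_≤ degree G r) (+-comm 2 _) (≤-trans (s≤s children<withNext) withNext<degree))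
    where
    r = cyc i
    IsChildOrNext : Fin n → Set
    IsChildOrNext w = IsChild r w ⊎ w ≡ cyc (next i)
    isChildOrNext? : ∀ w → Dec (IsChildOrNext w)
    isChildOrNext? w = isChild? r w ⊎-dec (w Fin.≟ cyc (next i))
    children<withNext = length-filter-mono-< (isChild? r) isChildOrNext? inj₁ (allFin n)
      (∈-allFin (cyc (next i))) (inj₂ refl) (λ (_ , ¬on) → ¬on (next i , refl))
    IsChildOrNext⇒Adj : ∀ {w} → IsChildOrNext w → Adj G r w
    IsChildOrNext⇒Adj (inj₁ child) = IsChild⇒Adj child
    IsChildOrNext⇒Adj (inj₂ refl) = Adj-up (up-cyc i)
    prev≢next : cyc (prev i) ≢ cyc (next i)
    prev≢next eq = next²-≢ 2≤m′ i (sym (trans (sym (next-prev i)) (cong next (cyc-inj eq))))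
    withNext<degree = length-filter-mono-< isChildOrNext? (adj? G r) IsChildOrNext⇒Adj (allFin n)
      (∈-allFin (cyc (prev i))) (Adj-down (trans (up-cyc (prev i)) (cong cyc (next-prev i))))
      Sum.[ (λ (_ , ¬on) → ¬on (prev i , refl)) , prev≢next ]

  Colour : Set
  Colour = Fin (suc (3 * Δ / 2))

  toColour : ℕ → Colour
  toColour x with x <? suc (3 * Δ / 2)
  ... | yes x<K = fromℕ< x<K
  ... | no _ = zero

  toColour-injective : ∀ {x y} → x < suc (3 * Δ / 2) → y < suc (3 * Δ / 2) → toColour x ≡ toColour y → x ≡ y
  toColour-injective {x} {y} x<K y<K eq with x <? suc (3 * Δ / 2) | y <? suc (3 * Δ / 2)
  ... | yes x<K′ | yes y<K′ = trans (sym (toℕ-fromℕ< x<K′)) (trans (cong toℕ eq) (toℕ-fromℕ< y<K′))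
  ... | no x≮K | _ = contradiction x<K x≮K
  ... | yes _ | no y≮K = contradiction y<K y≮K

  -- cycleCol i is the colour of the cycle edge {cyc i , cyc (next i)}.
  cycleCol : Fin (suc m) → Colour
  cycleCol i = toColour (cycleColour (suc m) (toℕ i))

  cyclePalette : List Colour
  cyclePalette = map toColour (upTo (paletteSize (suc m)))

  length-cyclePalette : length cyclePalette ≡ paletteSize (suc m)
  length-cyclePalette = trans (length-map toColour (upTo (paletteSize (suc m)))) (length-upTo _)

  cycleCol∈cyclePalette : ∀ i → cycleCol i ∈ cyclePalette
  cycleCol∈cyclePalette i = ∈-map⁺ toColour (∈-upTo⁺ (cycleColour<paletteSize (suc m) (toℕ i)))

  childColour : List Colour → ∀ x w → Dec (w ∈ children x) → Colour
  childColour F x w (yes w∈) = pickAvoiding F (length (children x)) (Any.index w∈)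
  childColour F x w (no _) = zero

  childColour-∉ : ∀ F x {w} → length (children x) + length F ≤ suc (3 * Δ / 2) →
    w ∈ children x → ∀ d → childColour F x w d ∉ F
  childColour-∉ F x room _ (yes w∈) = pickAvoiding-∉ F (length (children x)) room (Any.index w∈)
  childColour-∉ F x room w∈ (no w∉) = contradiction w∈ w∉

  childColour-injective : ∀ F x {v w} → length (children x) + length F ≤ suc (3 * Δ / 2) →
    v ∈ children x → w ∈ children x → ∀ dv dw → childColour F x v dv ≡ childColour F x w dw → v ≡ w
  childColour-injective F x room _ _ (yes v∈) (yes w∈) eq =
    index-injective v∈ w∈ (pickAvoiding-injective F (length (children x)) room _ _ eq)
  childColour-injective F x room v∈ _ (no v∉) _ _ = contradiction v∈ v∉
  childColour-injective F x room _ w∈ (yes _) (no w∉) _ = contradiction w∈ w∉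

  level1Colour : Fin n → Fin n → Colour
  level1Colour r v = childColour cyclePalette r v (v ∈? children r)

  -- The level-one colours of the ⌊t/2⌋ siblings following w in children x (t children in all).
  windowOf : ∀ x w → Dec (w ∈ children x) → List Colour
  windowOf x w (yes w∈) = cyclicWindow _ (pickAvoiding cyclePalette (length (children x))) (Any.index w∈)
  windowOf x w (no _) = []

  siblingWindow : Fin n → List Colour
  siblingWindow u = windowOf (up u) u (u ∈? children (up u))

  -- The colours of the cycle edges at a vertex of C: cyc i lies on the edges coloured
  -- cycleCol i and cycleCol (prev i), which coincide when C is a single edge.
  cycleColoursAt : Fin n → List Colour
  cycleColoursAt r with onC? r | shape
  ... | yes (i , _) | inj₁ _ = cycleCol i ∷ []
  ... | yes (i , _) | inj₂ _ = cycleCol i ∷ cycleCol (prev i) ∷ []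
  ... | no _ | _ = []

  forbiddenBelow : Fin n → List Colour
  forbiddenBelow u = cycleColoursAt (up u) List.++ (level1Colour (up u) u ∷ siblingWindow u)

  level2Colour : Fin n → Fin n → Colour
  level2Colour u w = childColour (forbiddenBelow u) u w (w ∈? children u)

  colourByLevel : ∀ v → Dec (OnC v) → Dec (OnC (up v)) → Colour
  colourByLevel v (yes (i , _)) _ = cycleCol i
  colourByLevel v (no _) (yes _) = level1Colour (up v) v
  colourByLevel v (no _) (no _) = level2Colour (up v) v

  opaque
    κ : Fin n → Colour
    κ v = colourByLevel v (onC? v) (onC? (up v))

    κ-cyc : ∀ i → κ (cyc i) ≡ cycleCol i
    κ-cyc i = onCycle (onC? (cyc i)) (onC? (up (cyc i)))
      where
      onCycle : ∀ d d′ → colourByLevel (cyc i) d d′ ≡ cycleCol i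
      onCycle (yes (j , cyc-j≡cyc-i)) _ = cong cycleCol (cyc-inj cyc-j≡cyc-i)
      onCycle (no ¬on) _ = contradiction (i , refl) ¬on

    κ-level1 : ∀ {v} → ¬ OnC v → OnC (up v) → κ v ≡ level1Colour (up v) v
    κ-level1 {v} ¬on on₁ = atLevel1 (onC? v) (onC? (up v))
      where
      atLevel1 : ∀ d d′ → colourByLevel v d d′ ≡ level1Colour (up v) v
      atLevel1 (yes on) _ = contradiction on ¬on
      atLevel1 (no _) (yes _) = refl
      atLevel1 (no _) (no ¬on₁) = contradiction on₁ ¬on₁

    κ-level2 : ∀ {v} → ¬ OnC v → ¬ OnC (up v) → κ v ≡ level2Colour (up v) v
    κ-level2 {v} ¬on ¬on₁ = atLevel2 (onC? v) (onC? (up v))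
      where
      atLevel2 : ∀ d d′ → colourByLevel v d d′ ≡ level2Colour (up v) v
      atLevel2 (yes on) _ = contradiction on ¬on
      atLevel2 (no _) (yes on₁) = contradiction on₁ ¬on₁
      atLevel2 (no _) (no _) = refl

  children+cycleDegree≤Δ : ∀ {r} → OnC r → length (children r) + cycleDegree (suc m) ≤ Δ
  children+cycleDegree≤Δ (i , refl) = ≤-trans (children+cycleDegree≤degree i) (degree≤Δ (cyc i))

  cycleRoom : ∀ {r} → OnC r → length (children r) + length cyclePalette ≤ suc (3 * Δ / 2)
  cycleRoom {r} on = subst (λ k → length (children r) + k ≤ suc (3 * Δ / 2)) (sym length-cyclePalette)
                           (paletteRoom (suc m) _ Δ (children+cycleDegree≤Δ on))

  length-cycleColoursAt : ∀ {r} → OnC r → length (cycleColoursAt r) ≡ cycleDegree (suc m)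
  length-cycleColoursAt {r} on with onC? r | shape
  ... | yes _ | inj₁ refl = refl
  ... | yes _ | inj₂ 2≤m′ = sym (cycleDegree-cycle 2≤m′)
  ... | no ¬on | _ = contradiction on ¬on

  length-siblingWindow : ∀ {u} → u ∈ children (up u) → length (siblingWindow u) ≡ length (children (up u)) / 2
  length-siblingWindow {u} u∈ with u ∈? children (up u)
  ... | yes u∈′ = length-cyclicWindow _ _ (Any.index u∈′)
  ... | no u∉ = contradiction u∈ u∉

  belowRoom : ∀ {u} → ¬ OnC u → OnC (up u) →
    length (children u) + length (forbiddenBelow u) ≤ suc (3 * Δ / 2)
  belowRoom {u} ¬on on₁ =
    subst (λ k → length (children u) + k ≤ suc (3 * Δ / 2)) (sym length-forbiddenBelow)
      (windowRoom (suc m) _ _ Δ (≤-trans (children<degree on₁) (degree≤Δ u)) (children+cycleDegree≤Δ on₁))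
    where
    length-forbiddenBelow : length (forbiddenBelow u) ≡ cycleDegree (suc m) + suc (length (children (up u)) / 2)
    length-forbiddenBelow =
      trans (length-++ (cycleColoursAt (up u)))
            (cong₂ _+_ (length-cycleColoursAt on₁) (cong suc (length-siblingWindow (∈-children refl ¬on))))

  κ∈cyclePalette : ∀ {v} → OnC v → κ v ∈ cyclePalette
  κ∈cyclePalette (i , refl) = subst (_∈ cyclePalette) (sym (κ-cyc i)) (cycleCol∈cyclePalette i)

  κ∉cyclePalette : ∀ {w} → ¬ OnC w → OnC (up w) → κ w ∉ cyclePalette
  κ∉cyclePalette {w} ¬on on₁ =
    subst (_∉ cyclePalette) (sym (κ-level1 ¬on on₁))
      (childColour-∉ cyclePalette (up w) (cycleRoom on₁) (∈-children refl ¬on) (w ∈? children (up w)))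

  κ∉forbiddenBelow : ∀ {w} → ¬ OnC w → ¬ OnC (up w) → κ w ∉ forbiddenBelow (up w)
  κ∉forbiddenBelow {w} ¬on ¬on₁ =
    subst (_∉ forbiddenBelow (up w)) (sym (κ-level2 ¬on ¬on₁))
      (childColour-∉ (forbiddenBelow (up w)) (up w) (belowRoom ¬on₁ (OnC-up² w)) (∈-children refl ¬on)
                     (w ∈? children (up w)))

  κ∈cycleColoursAt : ∀ {r} → OnC r → κ r ∈ cycleColoursAt r
  κ∈cycleColoursAt (i , refl) with onC? (cyc i) | shape
  ... | yes (j , cyc-j≡cyc-i) | inj₁ _ = here (trans (κ-cyc i) (cong cycleCol (sym (cyc-inj cyc-j≡cyc-i))))
  ... | yes (j , cyc-j≡cyc-i) | inj₂ _ = here (trans (κ-cyc i) (cong cycleCol (sym (cyc-inj cyc-j≡cyc-i))))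
  ... | no ¬on | _ = contradiction (i , refl) ¬on

  cycleCol∈cycleColoursAt-next : ∀ j → cycleCol j ∈ cycleColoursAt (cyc (next j))
  cycleCol∈cycleColoursAt-next j with onC? (cyc (next j)) | shape
  ... | yes _ | inj₁ m≡1 = here (cong toColour (cycleColour-edge m≡1 _ _))
  ... | yes (i , cyc-i≡cyc-next-j) | inj₂ _ = there (here (cong cycleCol (prev-unique (sym (cyc-inj cyc-i≡cyc-next-j)))))
  ... | no ¬on | _ = contradiction (next j , refl) ¬on

  κ∈cycleColoursAt-up : ∀ {v} → OnC v → κ v ∈ cycleColoursAt (up v)
  κ∈cycleColoursAt-up (j , refl) =
    subst₂ _∈_ (sym (κ-cyc j)) (cong cycleColoursAt (sym (up-cyc j))) (cycleCol∈cycleColoursAt-next j)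

  κ∈forbiddenBelow : ∀ {u} → ¬ OnC u → OnC (up u) → κ u ∈ forbiddenBelow u
  κ∈forbiddenBelow {u} ¬on on₁ =
    subst (_∈ forbiddenBelow u) (sym (κ-level1 ¬on on₁)) (∈-++⁺ʳ (cycleColoursAt (up u)) (here refl))

  κ-up∈forbiddenBelow : ∀ {u} → OnC (up u) → κ (up u) ∈ forbiddenBelow u
  κ-up∈forbiddenBelow on₁ = ∈-++⁺ˡ (κ∈cycleColoursAt on₁)

  κ-cycleSibling∈forbiddenBelow : ∀ {u v} → OnC v → up v ≡ up u → κ v ∈ forbiddenBelow u
  κ-cycleSibling∈forbiddenBelow on eq = ∈-++⁺ˡ (subst (λ r → _ ∈ cycleColoursAt r) eq (κ∈cycleColoursAt-up on))

  4≤#colours : 2 ≤ m → 4 ≤ suc (3 * Δ / 2)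
  4≤#colours 2≤m′ =
    ≤-trans (m≤n+m 4 (length (children (cyc zero))))
            (subst (λ k → length (children (cyc zero)) + k ≤ suc (3 * Δ / 2))
                   (trans length-cyclePalette (paletteSize-cycle 2≤m′)) (cycleRoom (zero , refl)))

  cycleCol≡⇒cycleColour≡ : 2 ≤ m → ∀ {i j} → cycleCol i ≡ cycleCol j →
    cycleColour (suc m) (toℕ i) ≡ cycleColour (suc m) (toℕ j)
  cycleCol≡⇒cycleColour≡ 2≤m′ = toColour-injective (fits _) (fits _)
    where
    fits : ∀ t → cycleColour (suc m) t < suc (3 * Δ / 2)
    fits t = ≤-trans (cycleColour<4 (suc m) t) (4≤#colours 2≤m′)

  cycleCol-next-≢ : 2 ≤ m → ∀ j → cycleCol (next j) ≢ cycleCol j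
  cycleCol-next-≢ 2≤m′ j eq =
    cycleColour-cyclicSuc-≢ (suc m) (toℕ j) (s≤s 2≤m′) (toℕ<n j)
      (trans (cong (cycleColour (suc m)) (sym (toℕ-next j))) (cycleCol≡⇒cycleColour≡ 2≤m′ eq))

  cycleCol-not-bicoloured : 2 ≤ m → ∀ j →
    ¬ (cycleCol j ≡ cycleCol (next (next j)) × cycleCol (next j) ≡ cycleCol (next (next (next j))))
  cycleCol-not-bicoloured 2≤m′ j (eq₀₂ , eq₁₃) =
    cycleColour-no-bicoloured (suc m) (toℕ j) (s≤s 2≤m′) (toℕ<n j)
      ( trans (cycleCol≡⇒cycleColour≡ 2≤m′ eq₀₂) (cong (cycleColour (suc m)) toℕ-next²)
      , trans (cong (cycleColour (suc m)) (sym (toℕ-next j)))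
              (trans (cycleCol≡⇒cycleColour≡ 2≤m′ eq₁₃) (cong (cycleColour (suc m)) toℕ-next³)))
    where
    toℕ-next² : toℕ (next (next j)) ≡ cyclicSuc (suc m) (cyclicSuc (suc m) (toℕ j))
    toℕ-next² = trans (toℕ-next (next j)) (cong (cyclicSuc (suc m)) (toℕ-next j))
    toℕ-next³ : toℕ (next (next (next j))) ≡ cyclicSuc (suc m) (cyclicSuc (suc m) (cyclicSuc (suc m) (toℕ j)))
    toℕ-next³ = trans (toℕ-next (next (next j))) (cong (cyclicSuc (suc m)) toℕ-next²)

  up-injective-on-C : ∀ {x y} → OnC x → OnC y → up x ≡ up y → x ≡ y
  up-injective-on-C (j , refl) (k , refl) eq =
    cong cyc (next-injective (cyc-inj (trans (sym (up-cyc j)) (trans eq (up-cyc k)))))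

  ¬OnC-child : ∀ {w u} → up w ≡ u → ¬ OnC u → ¬ OnC w
  ¬OnC-child refl ¬on on = ¬on (OnC-up on)

  up²-cyc : ∀ j → up (up (cyc j)) ≡ cyc (next (next j))
  up²-cyc j = trans (cong up (up-cyc j)) (up-cyc (next j))

  κ-up-cyc : ∀ j → κ (up (cyc j)) ≡ cycleCol (next j)
  κ-up-cyc j = trans (cong κ (up-cyc j)) (κ-cyc (next j))

  -- Only when C is a single edge is an edge owned by both of its ends.
  κ-twoCycle : ∀ {u} → up (up u) ≡ u → κ u ≡ κ (up u)
  κ-twoCycle {u} up²u≡u with subst OnC up²u≡u (OnC-up² u) | shape
  ... | (i , refl) | inj₁ m≡1 = trans (κ-cyc i) (trans (cong toColour (cycleColour-edge m≡1 _ _)) (sym (κ-up-cyc i)))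
  ... | (i , refl) | inj₂ 2≤m′ = contradiction (cyc-inj (trans (sym (up²-cyc i)) up²u≡u)) (next²-≢ 2≤m′ i)

  κ-up-≢ : ∀ {w} → w ≢ up (up w) → κ (up w) ≢ κ w
  κ-up-≢ {w} w≢up²w with onC? w | onC? (up w)
  ... | yes (j , refl) | _ with shape
  ...   | inj₁ m≡1 = λ _ → w≢up²w (sym (trans (up²-cyc j) (cong cyc (next²-edge m≡1 j))))
  ...   | inj₂ 2≤m′ = λ eq → cycleCol-next-≢ 2≤m′ j (trans (sym (κ-up-cyc j)) (trans eq (κ-cyc j)))
  κ-up-≢ {w} _ | no ¬on | yes on₁ = λ eq →
    κ∉cyclePalette ¬on on₁ (subst (_∈ cyclePalette) eq (κ∈cyclePalette on₁))
  κ-up-≢ {w} _ | no ¬on | no ¬on₁ = λ eq →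
    κ∉forbiddenBelow ¬on ¬on₁ (subst (_∈ forbiddenBelow (up w)) eq (κ∈forbiddenBelow ¬on₁ (OnC-up² w)))

  κ-up²-≢ : ∀ {w} → ¬ OnC w → κ w ≢ κ (up (up w))
  κ-up²-≢ {w} ¬on eq with onC? (up w)
  ... | yes on₁ = κ∉cyclePalette ¬on on₁ (subst (_∈ cyclePalette) (sym eq) (κ∈cyclePalette (OnC-up² w)))
  ... | no ¬on₁ = κ∉forbiddenBelow ¬on ¬on₁ (subst (_∈ forbiddenBelow (up w)) (sym eq) (κ-up∈forbiddenBelow (OnC-up² w)))

  κ-siblings-injective-off-C : ∀ {v w} → ¬ OnC v → ¬ OnC w → up v ≡ up w → κ v ≡ κ w → v ≡ w
  κ-siblings-injective-off-C {v} {w} ¬on ¬on′ eq κv≡κw with onC? (up v)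
  ... | yes on₁ =
    childColour-injective cyclePalette (up v) (cycleRoom on₁) (∈-children refl ¬on) (∈-children (sym eq) ¬on′)
      (v ∈? children (up v)) (w ∈? children (up v))
      (trans (sym (κ-level1 ¬on on₁))
             (trans κv≡κw (trans (κ-level1 ¬on′ (subst OnC eq on₁)) (cong (λ p → level1Colour p w) (sym eq)))))
  ... | no ¬on₁ =
    childColour-injective (forbiddenBelow (up v)) (up v) (belowRoom ¬on₁ (OnC-up² v))
      (∈-children refl ¬on) (∈-children (sym eq) ¬on′)
      (v ∈? children (up v)) (w ∈? children (up v))
      (trans (sym (κ-level2 ¬on ¬on₁))
             (trans κv≡κw (trans (κ-level2 ¬on′ (subst (¬_ ∘ OnC) eq ¬on₁)) (cong (λ p → level2Colour p w) (sym eq)))))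

  κ-siblings-≢ : ∀ {v w} → up v ≡ up w → v ≢ w → κ v ≢ κ w
  κ-siblings-≢ {v} {w} eq v≢w with onC? v | onC? w
  ... | yes on | yes on′ = λ _ → v≢w (up-injective-on-C on on′ eq)
  ... | yes on | no ¬on′ = λ κv≡κw →
    κ∉cyclePalette ¬on′ (subst OnC eq (OnC-up on)) (subst (_∈ cyclePalette) κv≡κw (κ∈cyclePalette on))
  ... | no ¬on | yes on′ = λ κv≡κw →
    κ∉cyclePalette ¬on (subst OnC (sym eq) (OnC-up on′)) (subst (_∈ cyclePalette) (sym κv≡κw) (κ∈cyclePalette on′))
  ... | no ¬on | no ¬on′ = v≢w ∘ κ-siblings-injective-off-C ¬on ¬on′ eq

  up²-cyc-edge : m ≡ 1 → ∀ j → up (up (cyc j)) ≡ cyc j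
  up²-cyc-edge m≡1 j = trans (up²-cyc j) (cong cyc (next²-edge m≡1 j))

  windowOf-either : ∀ {p y₁ y₂} → y₁ ∈ children p → y₂ ∈ children p → y₁ ≢ y₂ →
    level1Colour p y₂ ∈ windowOf p y₁ (y₁ ∈? children p) ⊎ level1Colour p y₁ ∈ windowOf p y₂ (y₂ ∈? children p)
  windowOf-either {p} {y₁} {y₂} y₁∈ y₂∈ y₁≢y₂ with y₁ ∈? children p | y₂ ∈? children p
  ... | yes y₁∈′ | yes y₂∈′ =
    cyclicWindow-either _ (pickAvoiding cyclePalette (length (children p))) (Any.index y₁∈′) (Any.index y₂∈′)
      (y₁≢y₂ ∘ index-injective y₁∈′ y₂∈′)
  ... | no y₁∉ | _ = contradiction y₁∈ y₁∉
  ... | yes _ | no y₂∉ = contradiction y₂∈ y₂∉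

  -- This is what the windows are for: of two siblings, each is within half a turn of the other
  -- in one direction.
  κ-siblings-in-window : ∀ {y₁ y₂} → ¬ OnC y₁ → ¬ OnC y₂ → up y₁ ≡ up y₂ → OnC (up y₁) → y₁ ≢ y₂ →
    κ y₂ ∈ forbiddenBelow y₁ ⊎ κ y₁ ∈ forbiddenBelow y₂
  κ-siblings-in-window {y₁} {y₂} ¬on₁ ¬on₂ eq on y₁≢y₂ =
    Sum.map (λ h → ∈-++⁺ʳ (cycleColoursAt (up y₁)) (there (subst (_∈ siblingWindow y₁) (sym κy₂) h)))
            (λ h → ∈-++⁺ʳ (cycleColoursAt (up y₂))
                     (there (subst₂ (λ c q → c ∈ windowOf q y₂ (y₂ ∈? children q)) (sym κy₁) eq h)))
            (windowOf-either (∈-children refl ¬on₁) (∈-children (sym eq) ¬on₂) y₁≢y₂)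
    where
    κy₁ : κ y₁ ≡ level1Colour (up y₁) y₁
    κy₁ = κ-level1 ¬on₁ on
    κy₂ : κ y₂ ≡ level1Colour (up y₁) y₂
    κy₂ = trans (κ-level1 ¬on₂ (subst OnC eq on)) (cong (λ q → level1Colour q y₂) (sym eq))

  rising-not-bicoloured : ∀ {u} → u ≢ up (up u) →
    ¬ (κ u ≡ κ (up (up u)) × κ (up u) ≡ κ (up (up (up u))))
  rising-not-bicoloured {u} u≢up²u with onC? u
  ... | no ¬on = λ (eq₀₂ , _) → κ-up²-≢ ¬on eq₀₂
  ... | yes (j , refl) with shape
  ...   | inj₁ m≡1 = λ _ → u≢up²u (sym (up²-cyc-edge m≡1 j))
  ...   | inj₂ 2≤m′ = λ (eq₀₂ , eq₁₃) → cycleCol-not-bicoloured 2≤m′ j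
    ( trans (sym (κ-cyc j)) (trans eq₀₂ (trans (cong κ (up²-cyc j)) (κ-cyc _)))
    , trans (sym (κ-up-cyc j)) (trans eq₁₃ (trans (cong κ (trans (cong up (up²-cyc j)) (up-cyc _))) (κ-cyc _))))

  rise³-fall-not-bicoloured : ∀ {x w} → up x ≡ up (up (up w)) → x ≢ up (up w) →
    ¬ (κ x ≡ κ (up w) × κ (up (up w)) ≡ κ w)
  rise³-fall-not-bicoloured {x} {w} eq x≢up²w with onC? x
  ... | yes on = λ _ → x≢up²w (up-injective-on-C on (OnC-up² w) eq)
  ... | no ¬onx with onC? (up w)
  ...   | yes on₁ = λ (eq₁ , _) →
    κ∉cyclePalette ¬onx (subst OnC (sym eq) (OnC-up (OnC-up² w)))
      (subst (_∈ cyclePalette) (sym eq₁) (κ∈cyclePalette on₁))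
  ...   | no ¬on₁ = λ (_ , eq₂) → κ-up²-≢ (¬OnC-child refl ¬on₁) (sym eq₂)

  rise²-fall²-not-bicoloured : ∀ {x₁ x₂} → up (up x₁) ≡ up (up x₂) → up x₁ ≢ up x₂ →
    ¬ (κ x₁ ≡ κ (up x₂) × κ (up x₁) ≡ κ x₂)
  rise²-fall²-not-bicoloured {x₁} {x₂} eq up-x₁≢up-x₂ with onC? (up x₁) | onC? (up x₂)
  ... | yes on₁ | yes on₂ = λ _ → up-x₁≢up-x₂ (up-injective-on-C on₁ on₂ eq)
  ... | yes on₁ | no ¬on₂ = λ (_ , eq₂) →
    κ∉forbiddenBelow (¬OnC-child refl ¬on₂) ¬on₂
      (subst (_∈ forbiddenBelow (up x₂)) eq₂ (κ-cycleSibling∈forbiddenBelow on₁ eq))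
  ... | no ¬on₁ | yes on₂ = λ (eq₁ , _) →
    κ∉forbiddenBelow (¬OnC-child refl ¬on₁) ¬on₁
      (subst (_∈ forbiddenBelow (up x₁)) (sym eq₁) (κ-cycleSibling∈forbiddenBelow on₂ (sym eq)))
  ... | no ¬on₁ | no ¬on₂ = λ (eq₁ , eq₂) →
    Sum.[ (λ h → κ∉forbiddenBelow (¬OnC-child refl ¬on₁) ¬on₁ (subst (_∈ forbiddenBelow (up x₁)) (sym eq₁) h))
        , (λ h → κ∉forbiddenBelow (¬OnC-child refl ¬on₂) ¬on₂ (subst (_∈ forbiddenBelow (up x₂)) eq₂ h)) ]
      (κ-siblings-in-window ¬on₁ ¬on₂ eq (OnC-up² x₁) up-x₁≢up-x₂)

  owner : ∀ u v → Dec (up u ≡ v) → Fin n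
  owner u v (yes _) = u
  owner u v (no _) = v

  edgeColour : Fin n → Fin n → Colour
  edgeColour u v = κ (owner u v (up u Fin.≟ v))

  edgeColour-up : ∀ {u v} → up u ≡ v → edgeColour u v ≡ κ u
  edgeColour-up {u} {v} up-u≡v with up u Fin.≟ v
  ... | yes _ = refl
  ... | no up-u≢v = contradiction up-u≡v up-u≢v

  edgeColour-down : ∀ {u v} → up v ≡ u → edgeColour u v ≡ κ v
  edgeColour-down {u} {v} up-v≡u with up u Fin.≟ v
  ... | yes up-u≡v = trans (κ-twoCycle (trans (cong up up-u≡v) up-v≡u)) (cong κ up-u≡v)
  ... | no _ = refl

  edgeColour-sym : ∀ {u v} → Adj G u v → edgeColour u v ≡ edgeColour v u
  edgeColour-sym uv with Adj⇒up uv
  ... | inj₁ up-u≡v = trans (edgeColour-up up-u≡v) (sym (edgeColour-down up-u≡v))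
  ... | inj₂ up-v≡u = trans (edgeColour-down up-v≡u) (sym (edgeColour-up up-v≡u))

  colouring : EdgeColoring G (suc (3 * Δ / 2))
  colouring = record { col = edgeColour ; col-sym = edgeColour-sym }

  colouring-proper : Proper colouring
  colouring-proper {u} {v} {w} uv uw v≢w with Adj⇒up uv | Adj⇒up uw
  ... | inj₁ up-u≡v | inj₁ up-u≡w = λ _ → v≢w (trans (sym up-u≡v) up-u≡w)
  ... | inj₁ up-u≡v | inj₂ up-w≡u = λ eq →
    κ-up-≢ (λ w≡up²w → v≢w (sym (trans w≡up²w (trans (cong up up-w≡u) up-u≡v))))
      (trans (cong κ up-w≡u) (trans (sym (edgeColour-up up-u≡v)) (trans eq (edgeColour-down up-w≡u))))
  ... | inj₂ up-v≡u | inj₁ up-u≡w = λ eq →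
    κ-up-≢ (λ v≡up²v → v≢w (trans v≡up²v (trans (cong up up-v≡u) up-u≡w)))
      (trans (cong κ up-v≡u) (trans (sym (edgeColour-up up-u≡w)) (trans (sym eq) (edgeColour-down up-v≡u))))
  ... | inj₂ up-v≡u | inj₂ up-w≡u = λ eq →
    κ-siblings-≢ (trans up-v≡u (sym up-w≡u)) v≢w
      (trans (sym (edgeColour-down up-v≡u)) (trans eq (edgeColour-down up-w≡u)))

  Step : Fin n → Fin n → Set
  Step u v = up u ≡ v ⊎ up v ≡ u

  -- Since up is a function, a walk never steps down and then up again, so a path of length
  -- four rises and then falls; up to reversal this leaves three shapes.
  path-not-alternating : ∀ {v₀ v₁ v₂ v₃ v₄} → Step v₀ v₁ → Step v₁ v₂ → Step v₂ v₃ → Step v₃ v₄ →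
    v₀ ≢ v₂ → v₁ ≢ v₃ → v₂ ≢ v₄ →
    ¬ (edgeColour v₀ v₁ ≡ edgeColour v₂ v₃ × edgeColour v₁ v₂ ≡ edgeColour v₃ v₄)
  path-not-alternating (inj₂ e₁) (inj₁ e₂) _ _ v₀≢v₂ _ _ _ = v₀≢v₂ (trans (sym e₁) e₂)
  path-not-alternating _ (inj₂ e₂) (inj₁ e₃) _ _ v₁≢v₃ _ _ = v₁≢v₃ (trans (sym e₂) e₃)
  path-not-alternating _ _ (inj₂ e₃) (inj₁ e₄) _ _ v₂≢v₄ _ = v₂≢v₄ (trans (sym e₃) e₄)
  path-not-alternating (inj₁ refl) (inj₁ refl) (inj₁ refl) (inj₁ refl) v₀≢v₂ _ _ (eq₀₂ , eq₁₃) =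
    rising-not-bicoloured v₀≢v₂
      ( trans (sym (edgeColour-up refl)) (trans eq₀₂ (edgeColour-up refl))
      , trans (sym (edgeColour-up refl)) (trans eq₁₃ (edgeColour-up refl)))
  path-not-alternating (inj₁ refl) (inj₁ refl) (inj₁ refl) (inj₂ e₄) _ _ v₂≢v₄ (eq₀₂ , eq₁₃) =
    rise³-fall-not-bicoloured e₄ (v₂≢v₄ ∘ sym)
      ( sym (trans (sym (edgeColour-up refl)) (trans eq₁₃ (edgeColour-down e₄)))
      , sym (trans (sym (edgeColour-up refl)) (trans eq₀₂ (edgeColour-up refl))))
  path-not-alternating (inj₁ refl) (inj₁ refl) (inj₂ e₃) (inj₂ refl) _ v₁≢v₃ _ (eq₀₂ , eq₁₃) =
    rise²-fall²-not-bicoloured (sym e₃) v₁≢v₃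
      ( trans (sym (edgeColour-up refl)) (trans eq₀₂ (edgeColour-down e₃))
      , trans (sym (edgeColour-up refl)) (trans eq₁₃ (edgeColour-down refl)))
  path-not-alternating (inj₁ e₁) (inj₂ refl) (inj₂ refl) (inj₂ refl) v₀≢v₂ _ _ (eq₀₂ , eq₁₃) =
    rise³-fall-not-bicoloured e₁ v₀≢v₂
      ( trans (sym (edgeColour-up e₁)) (trans eq₀₂ (edgeColour-down refl))
      , trans (sym (edgeColour-down refl)) (trans eq₁₃ (edgeColour-down refl)))
  path-not-alternating (inj₂ refl) (inj₂ refl) (inj₂ refl) (inj₂ refl) _ _ v₂≢v₄ (eq₀₂ , eq₁₃) =
    rising-not-bicoloured (v₂≢v₄ ∘ sym)
      ( sym (trans (sym (edgeColour-down refl)) (trans eq₁₃ (edgeColour-down refl)))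
      , sym (trans (sym (edgeColour-down refl)) (trans eq₀₂ (edgeColour-down refl))))

  colouring-star : ∀ v₀ v₁ v₂ v₃ v₄ → PathOrCycle4 G v₀ v₁ v₂ v₃ v₄ → ¬ BiColored colouring v₀ v₁ v₂ v₃ v₄
  colouring-star v₀ v₁ v₂ v₃ v₄ P (_ , _ , c₀₁ , c₁₂ , c₂₃ , c₃₄) =
    path-not-alternating (Adj⇒up a01) (Adj⇒up a12) (Adj⇒up a23) (Adj⇒up a34) d02 d13 d24
      (bicoloured-alternates c₀₁ c₁₂ c₂₃ c₃₄ (adjacent a01 a12 d02) (adjacent a12 a23 d13) (adjacent a23 a34 d24))
    where
    open PathOrCycle4 P
    adjacent : ∀ {x y z} → Adj G x y → Adj G y z → x ≢ z → edgeColour x y ≢ edgeColour y z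
    adjacent xy yz x≢z eq = colouring-proper (Graph.sym G xy) yz x≢z (trans (sym (edgeColour-sym xy)) eq)

mainTheorem1 : ∀ {n} (G : Graph n) → IsUCC G →
    StarColorable G (suc ((3 * maxDegree G) / 2))
mainTheorem1 G (U , G≅U) = colouring , colouring-proper , colouring-star
  where open UCCColouring G U G≅U
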